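{- Let $\theta:\mathcal{A}_0\cong\mathcal{B}_0$ be any isomorphism. Then there is an isomorphism $\rho:\mathcal{M}\cong\mathcal{N}$ such that $\rho\equiv_T\theta$.
   Context: All structures are relational. $\mathcal{H}$ has universe $H=[\omega]^{<\omega}\cup(\omega\times\{0,1\})$ ($[\omega]^{<\omega}$ the finite subsets of $\omega$, identified with characteristic functions) and binary relations $E_i$ ($i<\omega$), with $E_i(X,Y)$ iff $X,Y$ finite sets and $X\triangle Y=\{i\}$, and $D_i$, with $D_i(X,(i,a))$ iff $X$ is a finite set and $X(i)=a$ (nothing else). Computably composite structure: given a computable structure $\mathcal{S}$ with universe $S$ and a uniformly computable collection $\{\mathcal{C}_x:x\in S\}$ (uniformly computable languages and atomic diagrams) with pairwise disjoint universes $C_x$ disjoint from $S$, $\mathcal{S}[\{\mathcal{C}_x\}]$ has universe $S\cup\bigcup_xC_x$, a new binary relation $\mu=\{(c,x):c\in C_x\}\cup\{(x,x):x\in S\}$, the relations of $\mathcal{S}$ on $S$, the relations of each $\mathcal{C}_x$ on $C_x$, and nothing else. Fix uniformly computable collections $\{\mathcal{A}_i:i<\omega\}$, $\{\mathcal{B}_i:i<\omega\}$ with $\mathcal{A}_i\cong\mathcal{B}_i$. For $z\in H$ define: $\mathcal{M}_{(i,0)}=\mathcal{N}_{(i,0)}=\{(i,0)\}\times\mathcal{A}_{i+1}$; $\mathcal{M}_{(i,1)}=\mathcal{N}_{(i,1)}=\{(i,1)\}\times\mathcal{B}_{i+1}$; for $X\in[\omega]^{<\omega}$, $\mathcal{M}_X=\{X\}\times\mathcal{A}_0$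 and $\mathcal{N}_X=\{X\}\times\mathcal{B}_0$ if $|X|$ is even, and $\mathcal{M}_X=\{X\}\times\mathcal{B}_0$ and $\mathcal{N}_X=\{X\}\times\mathcal{A}_0$ if $|X|$ is odd ($\{z\}\times\mathcal{C}$ denotes the copy of $\mathcal{C}$ with universe $\{z\}\times C$). Let $\mathcal{M}=\mathcal{H}[\{\mathcal{M}_z:z\in H\}]$ and $\mathcal{N}=\mathcal{H}[\{\mathcal{N}_z:z\in H\}]$. -}

module Defs where

open import Data.Nat using (ℕ; zero; suc; _+_; _<_; ⌊_/2⌋)
open import Data.Bool using (Bool; true; false; if_then_else_; not)
open import Data.Fin using (Fin)
open import Data.Vec using (Vec; []; _∷_; lookup; map)
open import Data.Vec.Relation.Unary.All using (All)
open import Data.Product using (Σ; _×_; _,_)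
open import Data.Sum using (_⊎_)
open import Data.Empty using (⊥)
open import Relation.Nullary using (¬_)
open import Relation.Binary.PropositionalEquality using (_≡_)

tri : ℕ → ℕ
tri zero = zero
tri (suc n) = suc n + tri n

⟪_,_⟫ : ℕ → ℕ → ℕ
⟪ a , b ⟫ = tri (a + b) + b

tupleCode : ∀ {k} → Vec ℕ k → ℕ
tupleCode [] = 0
tupleCode (x ∷ xs) = ⟪ x , tupleCode xs ⟫

evenB : ℕ → Bool
evenB zero = true
evenB (suc n) = not (evenB n)

-- a finite subset of ω is coded by its canonical index  X = Σ_{i∈X} 2^i;
-- membership  i ∈ X  is the i-th binary digit (characteristic function X(i))
bit : ℕ → ℕ → Bool
bit n zero = not (evenB n)
bit n (suc i) = bit ⌊ n /2⌋ i

popFuel : ℕ → ℕ → ℕ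
popFuel zero n = 0
popFuel (suc f) n = (if bit n 0 then 1 else 0) + popFuel f ⌊ n /2⌋

-- |X|  (n has fewer than n+1 binary digits)
card : ℕ → ℕ
card n = popFuel (suc n) n

data PR : ℕ → Set where
  zer  : ∀ {n} → PR n
  sc   : PR 1
  prj  : ∀ {n} → Fin n → PR n
  orc  : PR 1
  cmp  : ∀ {m n} → PR m → Vec (PR n) m → PR n
  prec : ∀ {n} → PR n → PR (suc (suc n)) → PR (suc n)
  mu   : ∀ {n} → PR (suc n) → PR n

module _ (o : ℕ → ℕ) where
  mutual
    data Eval : ∀ {n} → PR n → Vec ℕ n → ℕ → Set where
      ev-zer  : ∀ {n} {xs : Vec ℕ n} → Eval zer xs 0
      ev-sc   : ∀ {x} → Eval sc (x ∷ []) (suc x)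
      ev-prj  : ∀ {n} {xs : Vec ℕ n} (i : Fin n) → Eval (prj i) xs (lookup xs i)
      ev-orc  : ∀ {x} → Eval orc (x ∷ []) (o x)
      ev-cmp  : ∀ {m n} {f : PR m} {gs : Vec (PR n) m} {xs ys y} →
                EvalV gs xs ys → Eval f ys y → Eval (cmp f gs) xs y
      ev-rec0 : ∀ {n} {g : PR n} {h} {xs y} →
                Eval g xs y → Eval (prec g h) (0 ∷ xs) y
      ev-recS : ∀ {n} {g : PR n} {h} {k xs y z} →
                Eval (prec g h) (k ∷ xs) y → Eval h (k ∷ y ∷ xs) z →
                Eval (prec g h) (suc k ∷ xs) z
      ev-mu   : ∀ {n} {f : PR (suc n)} {xs y} →
                Eval f (y ∷ xs) 0 →
                (∀ k → k < y → Σ ℕ λ v → Eval f (k ∷ xs) (suc v)) →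
                Eval (mu f) xs y

    data EvalV : ∀ {n m} → Vec (PR n) m → Vec ℕ n → Vec ℕ m → Set where
      evv-[] : ∀ {n} {xs : Vec ℕ n} → EvalV [] xs []
      evv-∷  : ∀ {n m} {g : PR n} {gs : Vec (PR n) m} {xs y ys} →
               Eval g xs y → EvalV gs xs ys → EvalV (g ∷ gs) xs (y ∷ ys)

_≤T_ : (ℕ → ℕ) → (ℕ → ℕ) → Set
f ≤T g = Σ (PR 1) λ e → ∀ x → Eval g e (x ∷ []) (f x)

_≡T_ : (ℕ → ℕ) → (ℕ → ℕ) → Set
f ≡T g = (f ≤T g) × (g ≤T f)

noOracle : ℕ → ℕ
noOracle _ = 0

Decides : ∀ {n} → PR n → Vec ℕ n → Set → Set
Decides e xs P = (Eval noOracle e xs 1 × P) ⊎ (Eval noOracle e xs 0 × ¬ P)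

-- Relational structures with universe ⊆ ω.
-- Relation symbols are pairs (name j, arity k); a structure interprets
-- every symbol (symbols outside its language are interpreted as empty).

record Str : Set₁ where
  field
    Dom : ℕ → Set
    Rel : (j k : ℕ) → Vec ℕ k → Set
open Str public

UnifComputable : (ℕ → Str) → Set
UnifComputable S =
  (Σ (PR 2) λ e → ∀ i x → Decides e (i ∷ x ∷ []) (Dom (S i) x)) ×
  (Σ (PR 4) λ e → ∀ i j k (xs : Vec ℕ k) → All (Dom (S i)) xs →
      Decides e (i ∷ j ∷ k ∷ tupleCode xs ∷ []) (Rel (S i) j k xs))

record Iso (S T : Str) : Set where
  field
    fun      : ℕ → ℕ
    pres-dom : ∀ x → Dom S x → Dom T (fun x)
    off-dom  : ∀ x → ¬ Dom S x → fun x ≡ 0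
    injective : ∀ x y → Dom S x → Dom S y → fun x ≡ fun y → x ≡ y
    surjective : ∀ y → Dom T y → Σ ℕ λ x → Dom S x × fun x ≡ y
    pres-rel : ∀ j k (xs : Vec ℕ k) → All (Dom S) xs →
               (Rel S j k xs → Rel T j k (map fun xs)) ×
               (Rel T j k (map fun xs) → Rel S j k xs)
open Iso public

-- elements of H = [ω]^{<ω} ∪ (ω × {0,1})
data HEl : Set where
  fset : ℕ → HEl
  pt   : ℕ → Bool → HEl

b2n : Bool → ℕ
b2n false = 0
b2n true = 1

hcode : HEl → ℕ
hcode (fset X) = ⟪ 0 , X ⟫
hcode (pt i a) = ⟪ 1 , ⟪ i , b2n a ⟫ ⟫

ccode : HEl → ℕ → ℕ
ccode z c = ⟪ 2 , ⟪ hcode z , c ⟫ ⟫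

Bin : (ℕ → ℕ → Set) → (k : ℕ) → Vec ℕ k → Set
Bin R 2 (u ∷ v ∷ []) = R u v
Bin R _ _ = ⊥

SymDiffIs : ℕ → ℕ → ℕ → Set
SymDiffIs X Y i = ∀ k → (¬ (bit X k ≡ bit Y k) → k ≡ i) × (k ≡ i → ¬ (bit X k ≡ bit Y k))

module Composite (C : HEl → Str) where

  Dom𝓒 : ℕ → Set
  Dom𝓒 n = (Σ HEl λ z → n ≡ hcode z) ⊎
           (Σ HEl λ z → Σ ℕ λ c → Dom (C z) c × n ≡ ccode z c)

  μR : ℕ → ℕ → Set
  μR u v = (Σ HEl λ z → Σ ℕ λ c → Dom (C z) c × u ≡ ccode z c × v ≡ hcode z) ⊎
           (Σ HEl λ z → u ≡ hcode z × v ≡ hcode z)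

  ER : ℕ → ℕ → ℕ → Set
  ER i u v = Σ ℕ λ X → Σ ℕ λ Y →
             u ≡ hcode (fset X) × v ≡ hcode (fset Y) × SymDiffIs X Y i

  DR : ℕ → ℕ → ℕ → Set
  DR i u v = Σ ℕ λ X → Σ Bool λ a →
             u ≡ hcode (fset X) × v ≡ hcode (pt i a) × bit X i ≡ a

  CR : ℕ → (k : ℕ) → Vec ℕ k → Set
  CR j k xs = Σ HEl λ z → Σ (Vec ℕ k) λ cs →
              All (Dom (C z)) cs × Rel (C z) j k cs × xs ≡ map (ccode z) cs

  Rel𝓒 : (j k : ℕ) → Vec ℕ k → Set
  Rel𝓒 j k xs =
    (j ≡ ⟪ 0 , 0 ⟫ × Bin μR k xs) ⊎
    ((Σ ℕ λ i → j ≡ ⟪ 1 , i ⟫ × Bin (ER i) k xs) ⊎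
    ((Σ ℕ λ i → j ≡ ⟪ 2 , i ⟫ × Bin (DR i) k xs) ⊎
     (Σ ℕ λ j' → j ≡ ⟪ 3 , j' ⟫ × CR j' k xs)))

  structure : Str
  structure = record { Dom = Dom𝓒 ; Rel = Rel𝓒 }

𝓗[_] : (HEl → Str) → Str
𝓗[ C ] = Composite.structure C

module _ (A B : ℕ → Str) where

  𝓜z : HEl → Str
  𝓜z (fset X) = if evenB (card X) then A 0 else B 0
  𝓜z (pt i false) = A (suc i)
  𝓜z (pt i true) = B (suc i)

  𝓝z : HEl → Str
  𝓝z (fset X) = if evenB (card X) then B 0 else A 0
  𝓝z (pt i false) = A (suc i)
  𝓝z (pt i true) = B (suc i)

  𝓜 : Str
  𝓜 = 𝓗[ 𝓜z ]

  𝓝 : Str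
  𝓝 = 𝓗[ 𝓝z ]

-- ρ fixes ℋ pointwise, is the identity on the components of the points (i , a), and on the
-- component of a finite set X it is θ or θ⁻¹ according to the parity of |X|.  Since the
-- domains of 𝒜₀ and ℬ₀ are decidable, θ⁻¹ c is found from θ by searching for the least
-- preimage of c, so ρ ≤T θ; conversely θ x is read off from ρ at the copy of x attached to ∅.
{-# OPTIONS --safe #-}
module Submission where

open import Defs
open import Data.Nat using (ℕ; zero; suc; _+_; _∸_; _<_; _≤_; _≟_; z≤n; s≤s; z<s; pred; ⌊_/2⌋; ∣_-_∣)
open import Data.Nat.Properties
open import Data.Bool using (Bool; true; false; if_then_else_)
open import Data.Fin using (Fin) renaming (zero to fzero; suc to fsuc)
open import Data.Vec using (Vec; []; _∷_; lookup; map)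
open import Data.Vec.Relation.Unary.All using (All; []; _∷_)
import Data.Vec.Relation.Unary.All as All
import Data.Vec.Relation.Unary.All.Properties as All
open import Data.Vec.Properties using (map-id; ∷-injectiveˡ; ∷-injectiveʳ)
open import Data.Product using (Σ; _×_; _,_; proj₁; proj₂)
open import Data.Sum using (_⊎_; inj₁; inj₂)
open import Data.Empty using (⊥-elim)
open import Relation.Nullary using (¬_; yes; no)
open import Relation.Binary using (tri<; tri≈; tri>)
open import Relation.Binary.PropositionalEquality
open import Function using (_∘_)

-- Arithmetic in primitive recursive form

isZero : ℕ → ℕ
isZero zero = 1
isZero (suc _) = 0

infix 0 ifNonZero_then_else_
ifNonZero_then_else_ : ℕ → ℕ → ℕ → ℕ
ifNonZero zero then a else b = b
ifNonZero suc _ then a else b = a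

equals : ℕ → ℕ → ℕ
equals x y = isZero ∣ x - y ∣

diagonal : ℕ → ℕ
diagonal zero = 0
diagonal (suc k) =
  ifNonZero equals (suc k) (tri (suc (diagonal k))) then suc (diagonal k) else diagonal k

unpair₂ : ℕ → ℕ
unpair₂ n = n ∸ tri (diagonal n)

unpair₁ : ℕ → ℕ
unpair₁ n = diagonal n ∸ unpair₂ n

parity : ℕ → ℕ
parity zero = 0
parity (suc k) = isZero (parity k)

half : ℕ → ℕ
half zero = 0
half (suc k) = half k + parity k

halveTimes : ℕ → ℕ → ℕ
halveTimes zero n = n
halveTimes (suc j) n = half (halveTimes j n)

ones : ℕ → ℕ → ℕ
ones zero n = 0
ones (suc f) n = ones f n + parity (halveTimes f n)

cardParity : ℕ → ℕ
cardParity X = parity (ones (suc X) X)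

∣-∣≡∸+∸ : ∀ x y → ∣ x - y ∣ ≡ (x ∸ y) + (y ∸ x)
∣-∣≡∸+∸ zero zero = refl
∣-∣≡∸+∸ zero (suc y) = refl
∣-∣≡∸+∸ (suc x) zero = sym (+-identityʳ (suc x))
∣-∣≡∸+∸ (suc x) (suc y) = ∣-∣≡∸+∸ x y

equals-refl : ∀ x → equals x x ≡ 1
equals-refl x = cong isZero (∣n-n∣≡0 x)

equals-≢ : ∀ {x y} → x ≢ y → equals x y ≡ 0
equals-≢ {x} {y} x≢y with ∣ x - y ∣ in eq
... | zero = ⊥-elim (x≢y (∣m-n∣≡0⇒m≡n eq))
... | suc _ = refl

tri-mono-≤ : ∀ {m n} → m ≤ n → tri m ≤ tri n
tri-mono-≤ {zero} _ = z≤n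
tri-mono-≤ {suc m} {suc n} (s≤s m≤n) = +-mono-≤ (s≤s m≤n) (tri-mono-≤ m≤n)

OnDiagonal : ℕ → ℕ → Set
OnDiagonal n s = tri s ≤ n × n < tri (suc s)

diagonal-next : ∀ k → suc k ≡ tri (suc (diagonal k)) → diagonal (suc k) ≡ suc (diagonal k)
diagonal-next k ≡next =
  cong (λ v → ifNonZero v then suc (diagonal k) else diagonal k)
       (trans (cong (equals (suc k)) (sym ≡next)) (equals-refl (suc k)))

diagonal-same : ∀ k → suc k ≢ tri (suc (diagonal k)) → diagonal (suc k) ≡ diagonal k
diagonal-same k ≢next = cong (λ v → ifNonZero v then suc (diagonal k) else diagonal k) (equals-≢ ≢next)

onDiagonal-diagonal : ∀ n → OnDiagonal n (diagonal n)
onDiagonal-diagonal zero = z≤n , s≤s z≤n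
onDiagonal-diagonal (suc k) with onDiagonal-diagonal k | suc k ≟ tri (suc (diagonal k))
... | lo , hi | no ≢next =
  subst (OnDiagonal (suc k)) (sym (diagonal-same k ≢next)) (m≤n⇒m≤1+n lo , ≤∧≢⇒< hi ≢next)
... | _ | yes ≡next = subst (OnDiagonal (suc k)) (sym (diagonal-next k ≡next))
  (subst (_≤ suc k) ≡next ≤-refl ,
   subst (λ v → suc k < suc (suc (diagonal k)) + v) ≡next (s≤s (m≤n+m (suc k) (suc (diagonal k)))))

onDiagonal-unique : ∀ {n s t} → OnDiagonal n s → OnDiagonal n t → s ≡ t
onDiagonal-unique {s = s} {t} (lo , hi) (lo′ , hi′) with <-cmp s t
... | tri≈ _ s≡t _ = s≡t
... | tri< s<t _ _ = ⊥-elim (<-irrefl refl (<-≤-trans hi (≤-trans (tri-mono-≤ s<t) lo′)))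
... | tri> _ _ t<s = ⊥-elim (<-irrefl refl (<-≤-trans hi′ (≤-trans (tri-mono-≤ t<s) lo)))

diagonal-pair : ∀ a b → diagonal ⟪ a , b ⟫ ≡ a + b
diagonal-pair a b = onDiagonal-unique (onDiagonal-diagonal ⟪ a , b ⟫) (lo , hi)
  where
  lo : tri (a + b) ≤ ⟪ a , b ⟫
  lo = m≤m+n (tri (a + b)) b
  hi : ⟪ a , b ⟫ < tri (suc (a + b))
  hi = subst (_< tri (suc (a + b))) (+-comm b (tri (a + b)))
             (+-monoˡ-< (tri (a + b)) (s≤s (m≤n+m b a)))

unpair₂-pair : ∀ a b → unpair₂ ⟪ a , b ⟫ ≡ b
unpair₂-pair a b rewrite diagonal-pair a b = m+n∸m≡n (tri (a + b)) b

unpair₁-pair : ∀ a b → unpair₁ ⟪ a , b ⟫ ≡ a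
unpair₁-pair a b rewrite unpair₂-pair a b | diagonal-pair a b = m+n∸n≡m a b

pair-unpair : ∀ n → ⟪ unpair₁ n , unpair₂ n ⟫ ≡ n
pair-unpair n = begin
  tri (unpair₁ n + unpair₂ n) + unpair₂ n ≡⟨ cong (λ s → tri s + unpair₂ n) (m∸n+n≡m unpair₂≤diagonal) ⟩
  tri (diagonal n) + unpair₂ n             ≡⟨ m+[n∸m]≡n lo ⟩
  n                                        ∎
  where
  open ≡-Reasoning
  lo = proj₁ (onDiagonal-diagonal n)
  hi = proj₂ (onDiagonal-diagonal n)
  unpair₂≤diagonal : unpair₂ n ≤ diagonal n
  unpair₂≤diagonal = <⇒≤pred (subst (unpair₂ n <_) (m+n∸n≡m (suc (diagonal n)) (tri (diagonal n)))
                                    (∸-monoˡ-< hi lo))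

unpair-β : ∀ {X : Set} (F : ℕ → ℕ → X) a b → F (unpair₁ ⟪ a , b ⟫) (unpair₂ ⟪ a , b ⟫) ≡ F a b
unpair-β F a b = cong₂ F (unpair₁-pair a b) (unpair₂-pair a b)

pair-injective : ∀ a b c d → ⟪ a , b ⟫ ≡ ⟪ c , d ⟫ → a ≡ c × b ≡ d
pair-injective a b c d eq =
  trans (sym (unpair₁-pair a b)) (trans (cong unpair₁ eq) (unpair₁-pair c d)) ,
  trans (sym (unpair₂-pair a b)) (trans (cong unpair₂ eq) (unpair₂-pair c d))

parity-evenB : ∀ m → parity m ≡ (if evenB m then 0 else 1)
parity-evenB zero = refl
parity-evenB (suc m) rewrite parity-evenB m with evenB m
... | true = refl
... | false = refl

parity+isZero-parity : ∀ m → parity m + isZero (parity m) ≡ 1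
parity+isZero-parity m rewrite parity-evenB m with evenB m
... | true = refl
... | false = refl

half≡⌊/2⌋ : ∀ n → half n ≡ ⌊ n /2⌋
half≡⌊/2⌋ zero = refl
half≡⌊/2⌋ (suc zero) = refl
half≡⌊/2⌋ (suc (suc n)) = begin
  half n + parity n + isZero (parity n)   ≡⟨ +-assoc (half n) (parity n) _ ⟩
  half n + (parity n + isZero (parity n)) ≡⟨ cong (half n +_) (parity+isZero-parity n) ⟩
  half n + 1                              ≡⟨ +-comm (half n) 1 ⟩
  suc (half n)                            ≡⟨ cong suc (half≡⌊/2⌋ n) ⟩
  suc ⌊ n /2⌋                             ∎
  where open ≡-Reasoning

halveTimes-suc : ∀ f n → halveTimes (suc f) n ≡ halveTimes f (half n)
halveTimes-suc zero n = refl
halveTimes-suc (suc f) n = cong half (halveTimes-suc f n)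

ones-suc : ∀ f n → ones (suc f) n ≡ parity n + ones f (half n)
ones-suc zero n = +-comm 0 (parity n)
ones-suc (suc f) n = begin
  ones f n + parity (halveTimes f n) + parity (halveTimes (suc f) n)
    ≡⟨ cong₂ _+_ (ones-suc f n) (cong parity (halveTimes-suc f n)) ⟩
  parity n + ones f (half n) + parity (halveTimes f (half n))
    ≡⟨ +-assoc (parity n) (ones f (half n)) _ ⟩
  parity n + ones (suc f) (half n) ∎
  where open ≡-Reasoning

lowestBit≡parity : ∀ n → (if bit n 0 then 1 else 0) ≡ parity n
lowestBit≡parity n rewrite parity-evenB n with evenB n
... | true = refl
... | false = refl

popFuel≡ones : ∀ f n → popFuel f n ≡ ones f n
popFuel≡ones zero n = refl
popFuel≡ones (suc f) n = begin
  (if bit n 0 then 1 else 0) + popFuel f ⌊ n /2⌋ ≡⟨ cong₂ _+_ (lowestBit≡parity n)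
                                                            (cong (popFuel f) (sym (half≡⌊/2⌋ n))) ⟩
  parity n + popFuel f (half n)                  ≡⟨ cong (parity n +_) (popFuel≡ones f (half n)) ⟩
  parity n + ones f (half n)                     ≡⟨ sym (ones-suc f n) ⟩
  ones (suc f) n                                 ∎
  where open ≡-Reasoning

cardParity-card : ∀ X → cardParity X ≡ (if evenB (card X) then 0 else 1)
cardParity-card X = trans (cong parity (sym (popFuel≡ones (suc X) X))) (parity-evenB (card X))

cardParity-cases : ∀ X (P : Bool → ℕ → Set) → P true 0 → P false 1 → P (evenB (card X)) (cardParity X)
cardParity-cases X P even odd rewrite cardParity-card X with evenB (card X)
... | true = even
... | false = odd

-- Oracle programs

dropOracle : ∀ {n} → PR n → PR n
dropOracles : ∀ {n m} → Vec (PR n) m → Vec (PR n) m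
dropOracle zer = zer
dropOracle sc = sc
dropOracle (prj i) = prj i
dropOracle orc = zer
dropOracle (cmp f gs) = cmp (dropOracle f) (dropOracles gs)
dropOracle (prec g h) = prec (dropOracle g) (dropOracle h)
dropOracle (mu f) = mu (dropOracle f)
dropOracles [] = []
dropOracles (g ∷ gs) = dropOracle g ∷ dropOracles gs

module _ (o : ℕ → ℕ) where
  Eval-dropOracle : ∀ {n} {e : PR n} {xs y} → Eval noOracle e xs y → Eval o (dropOracle e) xs y
  EvalV-dropOracles : ∀ {n m} {gs : Vec (PR n) m} {xs ys} →
                      EvalV noOracle gs xs ys → EvalV o (dropOracles gs) xs ys
  Eval-dropOracle ev-zer = ev-zer
  Eval-dropOracle ev-sc = ev-sc
  Eval-dropOracle (ev-prj i) = ev-prj i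
  Eval-dropOracle ev-orc = ev-zer
  Eval-dropOracle (ev-cmp gs f) = ev-cmp (EvalV-dropOracles gs) (Eval-dropOracle f)
  Eval-dropOracle (ev-rec0 g) = ev-rec0 (Eval-dropOracle g)
  Eval-dropOracle (ev-recS r h) = ev-recS (Eval-dropOracle r) (Eval-dropOracle h)
  Eval-dropOracle (ev-mu f below) =
    ev-mu (Eval-dropOracle f) (λ k k<y → proj₁ (below k k<y) , Eval-dropOracle (proj₂ (below k k<y)))
  EvalV-dropOracles evv-[] = evv-[]
  EvalV-dropOracles (evv-∷ g gs) = evv-∷ (Eval-dropOracle g) (EvalV-dropOracles gs)

unary : (ℕ → ℕ) → Vec ℕ 1 → ℕ
unary f (x ∷ []) = f x

binary : (ℕ → ℕ → ℕ) → Vec ℕ 2 → ℕ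
binary f (x ∷ y ∷ []) = f x y

ternary : (ℕ → ℕ → ℕ → ℕ) → Vec ℕ 3 → ℕ
ternary f (x ∷ y ∷ z ∷ []) = f x y z

primRec : ∀ {n} → (Vec ℕ n → ℕ) → (Vec ℕ (suc (suc n)) → ℕ) → Vec ℕ (suc n) → ℕ
primRec g h (zero ∷ xs) = g xs
primRec g h (suc k ∷ xs) = h (k ∷ primRec g h (k ∷ xs) ∷ xs)

IsLeastZero : (ℕ → ℕ) → ℕ → Set
IsLeastZero F y = F y ≡ 0 × (∀ k → k < y → Σ ℕ λ v → F k ≡ suc v)

leastZero : (F : ℕ → ℕ) (w : ℕ) → F w ≡ 0 → Σ ℕ (IsLeastZero F)
leastZero F w Fw≡0 = search 0 (λ _ ()) w refl
  where
  search : (i : ℕ) → (∀ k → k < i → Σ ℕ λ v → F k ≡ suc v) → (d : ℕ) → i + d ≡ w → Σ ℕ (IsLeastZero F)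
  search i below d i+d≡w with F i in Fi
  ... | zero = i , Fi , below
  ... | suc v with d
  ...   | zero = ⊥-elim (0≢1+n (trans (sym Fw≡0) (trans (cong F (trans (sym i+d≡w) (+-identityʳ i))) Fi)))
  ...   | suc d = search (suc i) below′ d (trans (sym (+-suc i d)) i+d≡w)
    where
    below′ : ∀ k → k < suc i → Σ ℕ λ u → F k ≡ suc u
    below′ k k<1+i with <-cmp k i
    ... | tri< k<i _ _ = below k k<i
    ... | tri≈ _ refl _ = v , Fi
    ... | tri> _ _ i<k = ⊥-elim (<-irrefl refl (<-≤-trans i<k (<⇒≤pred k<1+i)))

isLeastZero-0 : ∀ {F y} → IsLeastZero F y → F 0 ≡ 0 → y ≡ 0
isLeastZero-0 {y = zero} _ _ = refl
isLeastZero-0 {y = suc y} (_ , below) F0≡0 = ⊥-elim (0≢1+n (trans (sym F0≡0) (proj₂ (below 0 z<s))))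

module Programs (o : ℕ → ℕ) where

  record Prog (n : ℕ) : Set where
    constructor prog
    field
      code : PR n
      sem  : Vec ℕ n → ℕ
      eval : ∀ xs → Eval o code xs (sem xs)
  open Prog public

  private
    codes : ∀ {n m} → Vec (Prog n) m → Vec (PR n) m
    codes [] = []
    codes (g ∷ gs) = code g ∷ codes gs

    sems : ∀ {n m} → Vec (Prog n) m → Vec ℕ n → Vec ℕ m
    sems [] xs = []
    sems (g ∷ gs) xs = sem g xs ∷ sems gs xs

    evals : ∀ {n m} (gs : Vec (Prog n) m) xs → EvalV o (codes gs) xs (sems gs xs)
    evals [] xs = evv-[]
    evals (g ∷ gs) xs = evv-∷ (eval g xs) (evals gs xs)

  zeroᴾ : ∀ {n} → Prog n
  zeroᴾ = prog zer (λ _ → 0) (λ _ → ev-zer)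

  sucᴾ : Prog 1
  sucᴾ = prog sc (unary suc) (λ { (x ∷ []) → ev-sc })

  projᴾ : ∀ {n} → Fin n → Prog n
  projᴾ i = prog (prj i) (λ xs → lookup xs i) (λ _ → ev-prj i)

  oracleᴾ : Prog 1
  oracleᴾ = prog orc (unary o) (λ { (x ∷ []) → ev-orc })

  composeᴾ : ∀ {n m} → Prog m → Vec (Prog n) m → Prog n
  composeᴾ f gs = prog (cmp (code f) (codes gs)) (λ xs → sem f (sems gs xs))
                       (λ xs → ev-cmp (evals gs xs) (eval f (sems gs xs)))

  primRecᴾ : ∀ {n} → Prog n → Prog (suc (suc n)) → Prog (suc n)
  primRecᴾ g h = prog (prec (code g) (code h)) (primRec (sem g) (sem h)) evalRec
    where
    evalRec : ∀ xs → Eval o (prec (code g) (code h)) xs (primRec (sem g) (sem h) xs)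
    evalRec (zero ∷ xs) = ev-rec0 (eval g xs)
    evalRec (suc k ∷ xs) = ev-recS (evalRec (k ∷ xs)) (eval h _)

  minimiseᴾ : ∀ {n} (f : Prog (suc n)) (M : Vec ℕ n → ℕ) →
              (∀ xs → IsLeastZero (λ y → sem f (y ∷ xs)) (M xs)) → Prog n
  minimiseᴾ f M least = prog (mu (code f)) M λ xs →
    ev-mu (subst (Eval o (code f) _) (proj₁ (least xs)) (eval f _))
          (λ k k<M → proj₁ (proj₂ (least xs) k k<M) ,
                     subst (Eval o (code f) _) (proj₂ (proj₂ (least xs) k k<M)) (eval f _))

  withSem : ∀ {n} (p : Prog n) (F : Vec ℕ n → ℕ) → (∀ xs → sem p xs ≡ F xs) → Prog n
  withSem p F sem≡F = prog (code p) F (λ xs → subst (Eval o (code p) xs) (sem≡F xs) (eval p xs))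

  oracleFreeᴾ : ∀ {n} (e : PR n) (F : Vec ℕ n → ℕ) → (∀ xs → Eval noOracle e xs (F xs)) → Prog n
  oracleFreeᴾ e F ev = prog (dropOracle e) F (λ xs → Eval-dropOracle o (ev xs))

  arg₀ : ∀ {n} → Prog (suc n)
  arg₀ = projᴾ fzero

  arg₁ : ∀ {n} → Prog (suc (suc n))
  arg₁ = projᴾ (fsuc fzero)

  arg₂ : ∀ {n} → Prog (suc (suc (suc n)))
  arg₂ = projᴾ (fsuc (fsuc fzero))

  infixr 9 _∘ᴾ_
  _∘ᴾ_ : ∀ {n} → Prog 1 → Prog n → Prog n
  f ∘ᴾ g = composeᴾ f (g ∷ [])

  _⟨_,_⟩ : ∀ {n} → Prog 2 → Prog n → Prog n → Prog n
  f ⟨ g , h ⟩ = composeᴾ f (g ∷ h ∷ [])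

  constᴾ : ∀ {n} → ℕ → Prog n
  constᴾ {n} k = withSem (sucs k) (λ _ → k) (sem-sucs k)
    where
    sucs : ℕ → Prog n
    sucs zero = zeroᴾ
    sucs (suc k) = sucᴾ ∘ᴾ sucs k
    sem-sucs : ∀ k xs → sem (sucs k) xs ≡ k
    sem-sucs zero xs = refl
    sem-sucs (suc k) xs = cong suc (sem-sucs k xs)

  ifNonZeroᴾ : Prog 3
  ifNonZeroᴾ = withSem (primRecᴾ arg₁ arg₂) (ternary ifNonZero_then_else_)
    λ { (zero ∷ a ∷ b ∷ []) → refl ; (suc k ∷ a ∷ b ∷ []) → refl }

  infix 0 ifᴾ_then_else_
  ifᴾ_then_else_ : ∀ {n} → Prog n → Prog n → Prog n → Prog n
  ifᴾ t then a else b = composeᴾ ifNonZeroᴾ (t ∷ a ∷ b ∷ [])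

  addᴾ : Prog 2
  addᴾ = withSem (primRecᴾ arg₀ (sucᴾ ∘ᴾ arg₁)) (binary _+_) sem≡
    where
    sem≡ : ∀ xs → _ ≡ binary _+_ xs
    sem≡ (zero ∷ y ∷ []) = refl
    sem≡ (suc x ∷ y ∷ []) = cong suc (sem≡ (x ∷ y ∷ []))

  predᴾ : Prog 1
  predᴾ = withSem (primRecᴾ zeroᴾ arg₀) (unary pred) λ { (zero ∷ []) → refl ; (suc k ∷ []) → refl }

  monusᴾ : Prog 2
  monusᴾ = withSem (primRecᴾ arg₀ (predᴾ ∘ᴾ arg₁)) (binary (λ k x → x ∸ k)) sem≡ ⟨ arg₁ , arg₀ ⟩
    where
    sem≡ : ∀ xs → _ ≡ binary (λ k x → x ∸ k) xs
    sem≡ (zero ∷ x ∷ []) = refl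
    sem≡ (suc k ∷ x ∷ []) = trans (cong pred (sem≡ (k ∷ x ∷ []))) (pred[m∸n]≡m∸[1+n] x k)

  isZeroᴾ : Prog 1
  isZeroᴾ = withSem (primRecᴾ (constᴾ 1) zeroᴾ) (unary isZero)
    λ { (zero ∷ []) → refl ; (suc k ∷ []) → refl }

  distᴾ : Prog 2
  distᴾ = withSem (addᴾ ⟨ monusᴾ ⟨ arg₀ , arg₁ ⟩ , monusᴾ ⟨ arg₁ , arg₀ ⟩ ⟩) (binary ∣_-_∣)
    λ { (x ∷ y ∷ []) → sym (∣-∣≡∸+∸ x y) }

  equalsᴾ : Prog 2
  equalsᴾ = withSem (isZeroᴾ ∘ᴾ distᴾ) (binary equals) λ { (x ∷ y ∷ []) → refl }

  triᴾ : Prog 1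
  triᴾ = withSem (primRecᴾ zeroᴾ (addᴾ ⟨ sucᴾ ∘ᴾ arg₀ , arg₁ ⟩)) (unary tri) sem≡
    where
    sem≡ : ∀ xs → _ ≡ unary tri xs
    sem≡ (zero ∷ []) = refl
    sem≡ (suc k ∷ []) = cong (suc k +_) (sem≡ (k ∷ []))

  pairᴾ : Prog 2
  pairᴾ = withSem (addᴾ ⟨ triᴾ ∘ᴾ (addᴾ ⟨ arg₀ , arg₁ ⟩) , arg₁ ⟩) (binary ⟪_,_⟫) λ { (x ∷ y ∷ []) → refl }

  diagonalᴾ : Prog 1
  diagonalᴾ = withSem (primRecᴾ zeroᴾ step) (unary diagonal) sem≡
    where
    step : Prog 2
    step = ifᴾ equalsᴾ ⟨ sucᴾ ∘ᴾ arg₀ , triᴾ ∘ᴾ sucᴾ ∘ᴾ arg₁ ⟩ then sucᴾ ∘ᴾ arg₁ else arg₁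
    sem≡ : ∀ xs → _ ≡ unary diagonal xs
    sem≡ (zero ∷ []) = refl
    sem≡ (suc k ∷ []) =
      cong (λ d → ifNonZero equals (suc k) (tri (suc d)) then suc d else d) (sem≡ (k ∷ []))

  unpair₂ᴾ : Prog 1
  unpair₂ᴾ = withSem (monusᴾ ⟨ arg₀ , triᴾ ∘ᴾ diagonalᴾ ∘ᴾ arg₀ ⟩) (unary unpair₂) λ { (x ∷ []) → refl }

  unpair₁ᴾ : Prog 1
  unpair₁ᴾ = withSem (monusᴾ ⟨ diagonalᴾ ∘ᴾ arg₀ , unpair₂ᴾ ∘ᴾ arg₀ ⟩) (unary unpair₁) λ { (x ∷ []) → refl }

  parityᴾ : Prog 1
  parityᴾ = withSem (primRecᴾ zeroᴾ (isZeroᴾ ∘ᴾ arg₁)) (unary parity) sem≡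
    where
    sem≡ : ∀ xs → _ ≡ unary parity xs
    sem≡ (zero ∷ []) = refl
    sem≡ (suc k ∷ []) = cong isZero (sem≡ (k ∷ []))

  halfᴾ : Prog 1
  halfᴾ = withSem (primRecᴾ zeroᴾ (addᴾ ⟨ arg₁ , parityᴾ ∘ᴾ arg₀ ⟩)) (unary half) sem≡
    where
    sem≡ : ∀ xs → _ ≡ unary half xs
    sem≡ (zero ∷ []) = refl
    sem≡ (suc k ∷ []) = cong (_+ parity k) (sem≡ (k ∷ []))

  halveTimesᴾ : Prog 2
  halveTimesᴾ = withSem (primRecᴾ arg₀ (halfᴾ ∘ᴾ arg₁)) (binary halveTimes) sem≡
    where
    sem≡ : ∀ xs → _ ≡ binary halveTimes xs
    sem≡ (zero ∷ n ∷ []) = refl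
    sem≡ (suc k ∷ n ∷ []) = cong half (sem≡ (k ∷ n ∷ []))

  onesᴾ : Prog 2
  onesᴾ = withSem (primRecᴾ zeroᴾ (addᴾ ⟨ arg₁ , parityᴾ ∘ᴾ (halveTimesᴾ ⟨ arg₀ , arg₂ ⟩) ⟩))
                  (binary ones) sem≡
    where
    sem≡ : ∀ xs → _ ≡ binary ones xs
    sem≡ (zero ∷ n ∷ []) = refl
    sem≡ (suc k ∷ n ∷ []) = cong (_+ parity (halveTimes k n)) (sem≡ (k ∷ n ∷ []))

  cardParityᴾ : Prog 1
  cardParityᴾ = withSem (parityᴾ ∘ᴾ (onesᴾ ⟨ sucᴾ ∘ᴾ arg₀ , arg₀ ⟩)) (unary cardParity)
    λ { (x ∷ []) → refl }

-- Inverses of isomorphisms between decidable structures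

Characterises : ℕ → Set → Set
Characterises v P = (v ≡ 1 × P) ⊎ (v ≡ 0 × ¬ P)

characterises-yes : ∀ {v P} → Characterises v P → P → v ≡ 1
characterises-yes (inj₁ (v≡1 , _)) _ = v≡1
characterises-yes (inj₂ (_ , ¬p)) p = ⊥-elim (¬p p)

characterises-no : ∀ {v P} → Characterises v P → ¬ P → v ≡ 0
characterises-no (inj₁ (_ , p)) ¬p = ⊥-elim (¬p p)
characterises-no (inj₂ (v≡0 , _)) _ = v≡0

decision : ∀ {n} {e : PR n} {xs P} → Decides e xs P → ℕ
decision (inj₁ _) = 1
decision (inj₂ _) = 0

Eval-decision : ∀ {n} {e : PR n} {xs P} (d : Decides e xs P) → Eval noOracle e xs (decision d)
Eval-decision (inj₁ (ev , _)) = ev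
Eval-decision (inj₂ (ev , _)) = ev

decision-characterises : ∀ {n} {e : PR n} {xs P} (d : Decides e xs P) → Characterises (decision d) P
decision-characterises (inj₁ (_ , p)) = inj₁ (refl , p)
decision-characterises (inj₂ (_ , ¬p)) = inj₂ (refl , ¬p)

module Inverse {S T : Str} (θ : Iso S T) (χSᴾ χTᴾ : Programs.Prog (fun θ) 1)
  (χS-spec : ∀ x → Characterises (Programs.sem χSᴾ (x ∷ [])) (Dom S x))
  (χT-spec : ∀ x → Characterises (Programs.sem χTᴾ (x ∷ [])) (Dom T x)) where

  open Programs (fun θ)

  χS χT : ℕ → ℕ
  χS x = sem χSᴾ (x ∷ [])
  χT x = sem χTᴾ (x ∷ [])

  guarded : ℕ → ℕ → ℕ → ℕ
  guarded c∈T x∈S distance = ifNonZero c∈T then (ifNonZero x∈S then distance else 1) else 0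

  -- Zero exactly at the preimages of c when c ∈ T, and everywhere when c ∉ T, so that the
  -- least zero is 0 off the domain, as Iso demands.
  preimageTest : ℕ → ℕ → ℕ
  preimageTest x c = guarded (χT c) (χS x) ∣ fun θ x - c ∣

  preimageTest-zero : ∀ c → Σ ℕ λ x → preimageTest x c ≡ 0
  preimageTest-zero c with χT-spec c
  ... | inj₂ (χTc≡0 , _) = 0 , cong (λ v → guarded v (χS 0) ∣ fun θ 0 - c ∣) χTc≡0
  ... | inj₁ (χTc≡1 , c∈T) with surjective θ c c∈T
  ...   | x , x∈S , θx≡c =
    x , trans (cong₂ (λ u v → guarded u v ∣ fun θ x - c ∣) χTc≡1 (characterises-yes (χS-spec x) x∈S))
              (trans (cong (λ y → ∣ y - c ∣) θx≡c) (∣n-n∣≡0 c))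

  preimageTest-sound : ∀ {x c} → Dom T c → preimageTest x c ≡ 0 → Dom S x × fun θ x ≡ c
  preimageTest-sound {x} {c} c∈T test≡0 with χS-spec x
  ... | inj₁ (χSx≡1 , x∈S) =
    x∈S , ∣m-n∣≡0⇒m≡n (trans (sym (cong₂ (λ u v → guarded u v _) χTc≡1 χSx≡1)) test≡0)
    where χTc≡1 = characterises-yes (χT-spec c) c∈T
  ... | inj₂ (χSx≡0 , _) = ⊥-elim (1+n≢0 (trans (sym (cong₂ (λ u v → guarded u v _) χTc≡1 χSx≡0)) test≡0))
    where χTc≡1 = characterises-yes (χT-spec c) c∈T

  leastPreimage : ∀ c → Σ ℕ (IsLeastZero (λ x → preimageTest x c))
  leastPreimage c = leastZero (λ x → preimageTest x c) (proj₁ (preimageTest-zero c))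
                                                        (proj₂ (preimageTest-zero c))

  inverse : ℕ → ℕ
  inverse c = proj₁ (leastPreimage c)

  inverse-spec : ∀ {c} → Dom T c → Dom S (inverse c) × fun θ (inverse c) ≡ c
  inverse-spec {c} c∈T = preimageTest-sound c∈T (proj₁ (proj₂ (leastPreimage c)))

  inverse-off : ∀ c → ¬ Dom T c → inverse c ≡ 0
  inverse-off c c∉T = isLeastZero-0 (proj₂ (leastPreimage c))
    (cong (λ v → guarded v (χS 0) ∣ fun θ 0 - c ∣) (characterises-no (χT-spec c) c∉T))

  inverse-θ : ∀ {x} → Dom S x → inverse (fun θ x) ≡ x
  inverse-θ {x} x∈S = injective θ _ x (proj₁ spec) x∈S (proj₂ spec)
    where spec = inverse-spec (pres-dom θ x x∈S)

  θ∘inverse : ∀ {k} {cs : Vec ℕ k} → All (Dom T) cs → map (fun θ) (map inverse cs) ≡ cs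
  θ∘inverse [] = refl
  θ∘inverse (c∈T ∷ cs∈T) = cong₂ _∷_ (proj₂ (inverse-spec c∈T)) (θ∘inverse cs∈T)

  θ⁻¹ : Iso T S
  θ⁻¹ = record
    { fun = inverse
    ; pres-dom = λ c c∈T → proj₁ (inverse-spec c∈T)
    ; off-dom = inverse-off
    ; injective = λ c d c∈T d∈T eq →
        trans (sym (proj₂ (inverse-spec c∈T))) (trans (cong (fun θ) eq) (proj₂ (inverse-spec d∈T)))
    ; surjective = λ x x∈S → fun θ x , pres-dom θ x x∈S , inverse-θ x∈S
    ; pres-rel = λ j k cs cs∈T →
        let θ-rel = pres-rel θ j k (map inverse cs)
                      (All.map⁺ (All.map (λ c∈T → proj₁ (inverse-spec c∈T)) cs∈T))
        in (λ r → proj₂ θ-rel (subst (Rel T j k) (sym (θ∘inverse cs∈T)) r)) ,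
           (λ r → subst (Rel T j k) (θ∘inverse cs∈T) (proj₁ θ-rel r))
    }

  inverseᴾ : Prog 1
  inverseᴾ = minimiseᴾ preimageTestᴾ (unary inverse) λ { (c ∷ []) → proj₂ (leastPreimage c) }
    where
    preimageTestᴾ : Prog 2
    preimageTestᴾ = withSem
      (ifᴾ χTᴾ ∘ᴾ arg₁
         then (ifᴾ χSᴾ ∘ᴾ arg₀ then distᴾ ⟨ oracleᴾ ∘ᴾ arg₀ , arg₁ ⟩ else constᴾ 1)
         else zeroᴾ)
      (binary preimageTest) λ { (x ∷ c ∷ []) → refl }

-- Isomorphisms of composite structures

-- Unlike Iso, nothing is required off the domain, so that the identity qualifies.
record _≅_ (S T : Str) : Set where
  field
    to : ℕ → ℕ
    to-dom : ∀ x → Dom S x → Dom T (to x)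
    to-injective : ∀ x y → Dom S x → Dom S y → to x ≡ to y → x ≡ y
    to-surjective : ∀ y → Dom T y → Σ ℕ λ x → Dom S x × to x ≡ y
    to-rel : ∀ j k (xs : Vec ℕ k) → All (Dom S) xs →
             (Rel S j k xs → Rel T j k (map to xs)) × (Rel T j k (map to xs) → Rel S j k xs)
open _≅_

Iso⇒≅ : ∀ {S T} → Iso S T → S ≅ T
Iso⇒≅ θ = record
  { to = fun θ ; to-dom = pres-dom θ ; to-injective = injective θ
  ; to-surjective = surjective θ ; to-rel = pres-rel θ }

≅-refl : ∀ {S} → S ≅ S
≅-refl {S} = record
  { to = λ x → x ; to-dom = λ _ x∈S → x∈S ; to-injective = λ _ _ _ _ eq → eq
  ; to-surjective = λ y y∈S → y , y∈S , refl
  ; to-rel = λ j k xs _ → subst (Rel S j k) (sym (map-id xs)) , subst (Rel S j k) (map-id xs) }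

≅-if : ∀ {S S′ T T′} (b : Bool) → S ≅ T → S′ ≅ T′ → (if b then S else S′) ≅ (if b then T else T′)
≅-if true φ _ = φ
≅-if false _ φ = φ

Bin-map : ∀ {P : ℕ → Set} {R R′ : ℕ → ℕ → Set} (f : ℕ → ℕ) →
          (∀ {u v} → P u → P v → R u v → R′ (f u) (f v)) →
          ∀ {k} {xs : Vec ℕ k} → All P xs → Bin R k xs → Bin R′ k (map f xs)
Bin-map f preserve {2} (pu ∷ pv ∷ []) r = preserve pu pv r

Bin-map⁻ : ∀ {P : ℕ → Set} {R R′ : ℕ → ℕ → Set} (f : ℕ → ℕ) →
           (∀ {u v} → P u → P v → R′ (f u) (f v) → R u v) →
           ∀ {k} {xs : Vec ℕ k} → All P xs → Bin R′ k (map f xs) → Bin R k xs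
Bin-map⁻ f reflect {2} (pu ∷ pv ∷ []) r = reflect pu pv r

b2n-injective : ∀ {a b} → b2n a ≡ b2n b → a ≡ b
b2n-injective {false} {false} _ = refl
b2n-injective {true} {true} _ = refl

hcode≢ccode : ∀ z z′ c → hcode z ≢ ccode z′ c
hcode≢ccode (fset X) z′ c eq with () ← proj₁ (pair-injective 0 X 2 ⟪ hcode z′ , c ⟫ eq)
hcode≢ccode (pt i a) z′ c eq with () ← proj₁ (pair-injective 1 ⟪ i , b2n a ⟫ 2 ⟪ hcode z′ , c ⟫ eq)

hcode-injective : ∀ z z′ → hcode z ≡ hcode z′ → z ≡ z′
hcode-injective (fset X) (fset Y) eq = cong fset (proj₂ (pair-injective 0 X 0 Y eq))
hcode-injective (fset X) (pt i a) eq with () ← proj₁ (pair-injective 0 X 1 ⟪ i , b2n a ⟫ eq)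
hcode-injective (pt i a) (fset Y) eq with () ← proj₁ (pair-injective 1 ⟪ i , b2n a ⟫ 0 Y eq)
hcode-injective (pt i a) (pt j b) eq
  with pair-injective i (b2n a) j (b2n b) (proj₂ (pair-injective 1 ⟪ i , b2n a ⟫ 1 ⟪ j , b2n b ⟫ eq))
... | i≡j , a≡b = cong₂ pt i≡j (b2n-injective a≡b)

ccode-injective : ∀ z z′ {c c′} → ccode z c ≡ ccode z′ c′ → z ≡ z′ × c ≡ c′
ccode-injective z z′ {c} {c′} eq
  with pair-injective (hcode z) c (hcode z′) c′ (proj₂ (pair-injective 2 ⟪ hcode z , c ⟫ 2 ⟪ hcode z′ , c′ ⟫ eq))
... | z≡z′ , c≡c′ = hcode-injective z z′ z≡z′ , c≡c′

ccode-dom⁻ : ∀ {C} z {c} → Dom 𝓗[ C ] (ccode z c) → Dom (C z) c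
ccode-dom⁻ z (inj₁ (w , eq)) = ⊥-elim (hcode≢ccode w z _ (sym eq))
ccode-dom⁻ z (inj₂ (w , c′ , c′∈C , eq)) with ccode-injective z w eq
... | refl , refl = c′∈C

readOff-≤T : ∀ {f g : ℕ → ℕ} z → (∀ x → unpair₂ (unpair₂ (g (ccode z x))) ≡ f x) → f ≤T g
readOff-≤T {f} {g} z readOff = code read , λ x → eval read (x ∷ [])
  where
  open Programs g
  read : Prog 1
  read = withSem (unpair₂ᴾ ∘ᴾ unpair₂ᴾ ∘ᴾ oracleᴾ ∘ᴾ pairᴾ ⟨ constᴾ 2 , pairᴾ ⟨ constᴾ (hcode z) , arg₀ ⟩ ⟩)
                 (unary f) λ { (x ∷ []) → readOff x }

module CompositeIso {C D : HEl → Str} (Φ : ∀ z → C z ≅ D z) (ρ : ℕ → ℕ)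
  (ρ-hcode : ∀ z → ρ (hcode z) ≡ hcode z)
  (ρ-ccode : ∀ z {c} → Dom (C z) c → ρ (ccode z c) ≡ ccode z (to (Φ z) c))
  (ρ-off : ∀ n → ¬ Dom 𝓗[ C ] n → ρ n ≡ 0) where

  module 𝓒 = Composite C
  module 𝓓 = Composite D

  DomC : ℕ → Set
  DomC = Dom 𝓗[ C ]

  ρ-hcode⁻ : ∀ {u} z → DomC u → ρ u ≡ hcode z → u ≡ hcode z
  ρ-hcode⁻ z (inj₁ (w , refl)) eq = trans (sym (ρ-hcode w)) eq
  ρ-hcode⁻ z (inj₂ (w , c , c∈C , refl)) eq = ⊥-elim (hcode≢ccode z w _ (trans (sym eq) (ρ-ccode w c∈C)))

  ρ-ccode⁻ : ∀ {u} z {c′} → DomC u → ρ u ≡ ccode z c′ →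
             Σ ℕ λ c → Dom (C z) c × u ≡ ccode z c × to (Φ z) c ≡ c′
  ρ-ccode⁻ z (inj₁ (w , refl)) eq = ⊥-elim (hcode≢ccode w z _ (trans (sym (ρ-hcode w)) eq))
  ρ-ccode⁻ z (inj₂ (w , c , c∈C , refl)) eq with ccode-injective w z (trans (sym (ρ-ccode w c∈C)) eq)
  ... | refl , Φc≡c′ = c , c∈C , refl , Φc≡c′

  map-ρ-ccode : ∀ z {k} {cs : Vec ℕ k} → All (Dom (C z)) cs →
                map ρ (map (ccode z) cs) ≡ map (ccode z) (map (to (Φ z)) cs)
  map-ρ-ccode z [] = refl
  map-ρ-ccode z (c∈C ∷ cs∈C) = cong₂ _∷_ (ρ-ccode z c∈C) (map-ρ-ccode z cs∈C)

  map-ρ-ccode⁻ : ∀ z {k} {xs : Vec ℕ k} {cs′} → All DomC xs → map ρ xs ≡ map (ccode z) cs′ →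
                 Σ (Vec ℕ k) λ cs → All (Dom (C z)) cs × xs ≡ map (ccode z) cs × map (to (Φ z)) cs ≡ cs′
  map-ρ-ccode⁻ z {xs = []} {[]} [] _ = [] , [] , refl , refl
  map-ρ-ccode⁻ z {xs = x ∷ xs} {c′ ∷ cs′} (x∈C ∷ xs∈C) eq
    with ρ-ccode⁻ z x∈C (∷-injectiveˡ eq) | map-ρ-ccode⁻ z xs∈C (∷-injectiveʳ eq)
  ... | c , c∈C , refl , Φc≡c′ | cs , cs∈C , refl , Φcs≡cs′ =
    c ∷ cs , c∈C ∷ cs∈C , refl , cong₂ _∷_ Φc≡c′ Φcs≡cs′

  μ-preserved : ∀ {u v} → DomC u → DomC v → 𝓒.μR u v → 𝓓.μR (ρ u) (ρ v)
  μ-preserved _ _ (inj₁ (z , c , c∈C , refl , refl)) =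
    inj₁ (z , to (Φ z) c , to-dom (Φ z) c c∈C , ρ-ccode z c∈C , ρ-hcode z)
  μ-preserved _ _ (inj₂ (z , refl , refl)) = inj₂ (z , ρ-hcode z , ρ-hcode z)

  μ-reflected : ∀ {u v} → DomC u → DomC v → 𝓓.μR (ρ u) (ρ v) → 𝓒.μR u v
  μ-reflected u∈C v∈C (inj₁ (z , c′ , _ , ρu≡ , ρv≡)) with ρ-ccode⁻ z u∈C ρu≡
  ... | c , c∈C , u≡ , _ = inj₁ (z , c , c∈C , u≡ , ρ-hcode⁻ z v∈C ρv≡)
  μ-reflected u∈C v∈C (inj₂ (z , ρu≡ , ρv≡)) = inj₂ (z , ρ-hcode⁻ z u∈C ρu≡ , ρ-hcode⁻ z v∈C ρv≡)

  E-preserved : ∀ i {u v} → DomC u → DomC v → 𝓒.ER i u v → 𝓓.ER i (ρ u) (ρ v)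
  E-preserved i _ _ (X , Y , refl , refl , X△Y) = X , Y , ρ-hcode (fset X) , ρ-hcode (fset Y) , X△Y

  E-reflected : ∀ i {u v} → DomC u → DomC v → 𝓓.ER i (ρ u) (ρ v) → 𝓒.ER i u v
  E-reflected i u∈C v∈C (X , Y , ρu≡ , ρv≡ , X△Y) =
    X , Y , ρ-hcode⁻ (fset X) u∈C ρu≡ , ρ-hcode⁻ (fset Y) v∈C ρv≡ , X△Y

  D-preserved : ∀ i {u v} → DomC u → DomC v → 𝓒.DR i u v → 𝓓.DR i (ρ u) (ρ v)
  D-preserved i _ _ (X , a , refl , refl , Xi≡a) = X , a , ρ-hcode (fset X) , ρ-hcode (pt i a) , Xi≡a

  D-reflected : ∀ i {u v} → DomC u → DomC v → 𝓓.DR i (ρ u) (ρ v) → 𝓒.DR i u v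
  D-reflected i u∈C v∈C (X , a , ρu≡ , ρv≡ , Xi≡a) =
    X , a , ρ-hcode⁻ (fset X) u∈C ρu≡ , ρ-hcode⁻ (pt i a) v∈C ρv≡ , Xi≡a

  rel-preserved : ∀ j k (xs : Vec ℕ k) → All DomC xs → Rel 𝓗[ C ] j k xs → Rel 𝓗[ D ] j k (map ρ xs)
  rel-preserved j k xs xs∈C (inj₁ (j≡ , r)) = inj₁ (j≡ , Bin-map ρ μ-preserved xs∈C r)
  rel-preserved j k xs xs∈C (inj₂ (inj₁ (i , j≡ , r))) =
    inj₂ (inj₁ (i , j≡ , Bin-map ρ (E-preserved i) xs∈C r))
  rel-preserved j k xs xs∈C (inj₂ (inj₂ (inj₁ (i , j≡ , r)))) =
    inj₂ (inj₂ (inj₁ (i , j≡ , Bin-map ρ (D-preserved i) xs∈C r)))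
  rel-preserved j k xs xs∈C (inj₂ (inj₂ (inj₂ (j′ , j≡ , z , cs , cs∈C , r , refl)))) =
    inj₂ (inj₂ (inj₂ (j′ , j≡ , z , map (to (Φ z)) cs ,
      All.map⁺ (All.map (λ {c} → to-dom (Φ z) c) cs∈C) ,
      proj₁ (to-rel (Φ z) j′ k cs cs∈C) r , map-ρ-ccode z cs∈C)))

  rel-reflected : ∀ j k (xs : Vec ℕ k) → All DomC xs → Rel 𝓗[ D ] j k (map ρ xs) → Rel 𝓗[ C ] j k xs
  rel-reflected j k xs xs∈C (inj₁ (j≡ , r)) = inj₁ (j≡ , Bin-map⁻ ρ μ-reflected xs∈C r)
  rel-reflected j k xs xs∈C (inj₂ (inj₁ (i , j≡ , r))) =
    inj₂ (inj₁ (i , j≡ , Bin-map⁻ ρ (E-reflected i) xs∈C r))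
  rel-reflected j k xs xs∈C (inj₂ (inj₂ (inj₁ (i , j≡ , r)))) =
    inj₂ (inj₂ (inj₁ (i , j≡ , Bin-map⁻ ρ (D-reflected i) xs∈C r)))
  rel-reflected j k xs xs∈C (inj₂ (inj₂ (inj₂ (j′ , j≡ , z , cs′ , _ , r′ , ρxs≡))))
    with map-ρ-ccode⁻ z xs∈C ρxs≡
  ... | cs , cs∈C , xs≡ , refl =
    inj₂ (inj₂ (inj₂ (j′ , j≡ , z , cs , cs∈C , proj₂ (to-rel (Φ z) j′ k cs cs∈C) r′ , xs≡)))

  ρ-dom : ∀ x → DomC x → Dom 𝓗[ D ] (ρ x)
  ρ-dom _ (inj₁ (z , refl)) = inj₁ (z , ρ-hcode z)
  ρ-dom _ (inj₂ (z , c , c∈C , refl)) = inj₂ (z , to (Φ z) c , to-dom (Φ z) c c∈C , ρ-ccode z c∈C)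

  ρ-injective : ∀ x y → DomC x → DomC y → ρ x ≡ ρ y → x ≡ y
  ρ-injective x y x∈C (inj₁ (z , refl)) ρx≡ρy = ρ-hcode⁻ z x∈C (trans ρx≡ρy (ρ-hcode z))
  ρ-injective x y x∈C (inj₂ (z , c , c∈C , refl)) ρx≡ρy
    with ρ-ccode⁻ z x∈C (trans ρx≡ρy (ρ-ccode z c∈C))
  ... | c′ , c′∈C , refl , Φc′≡Φc = cong (ccode z) (to-injective (Φ z) c′ c c′∈C c∈C Φc′≡Φc)

  ρ-surjective : ∀ y → Dom 𝓗[ D ] y → Σ ℕ λ x → DomC x × ρ x ≡ y
  ρ-surjective _ (inj₁ (z , refl)) = hcode z , inj₁ (z , refl) , ρ-hcode z
  ρ-surjective _ (inj₂ (z , d , d∈D , refl)) with to-surjective (Φ z) d d∈D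
  ... | c , c∈C , Φc≡d = ccode z c , inj₂ (z , c , c∈C , refl) , trans (ρ-ccode z c∈C) (cong (ccode z) Φc≡d)

  iso : Iso 𝓗[ C ] 𝓗[ D ]
  iso = record
    { fun = ρ
    ; pres-dom = ρ-dom
    ; off-dom = ρ-off
    ; injective = ρ-injective
    ; surjective = ρ-surjective
    ; pres-rel = λ j k xs xs∈C → rel-preserved j k xs xs∈C , rel-reflected j k xs xs∈C
    }

-- The isomorphism ρ : 𝓜 ≅ 𝓝

module Construction (A B : ℕ → Str) (UA : UnifComputable A) (UB : UnifComputable B)
                    (θ : Iso (A 0) (B 0)) where

  open Programs (fun θ)

  decA : ∀ i x → Decides (proj₁ (proj₁ UA)) (i ∷ x ∷ []) (Dom (A i) x)
  decA = proj₂ (proj₁ UA)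

  decB : ∀ i x → Decides (proj₁ (proj₁ UB)) (i ∷ x ∷ []) (Dom (B i) x)
  decB = proj₂ (proj₁ UB)

  χA χB : ℕ → ℕ → ℕ
  χA i x = decision (decA i x)
  χB i x = decision (decB i x)

  χAᴾ χBᴾ : Prog 2
  χAᴾ = oracleFreeᴾ (proj₁ (proj₁ UA)) (binary χA) λ { (i ∷ x ∷ []) → Eval-decision (decA i x) }
  χBᴾ = oracleFreeᴾ (proj₁ (proj₁ UB)) (binary χB) λ { (i ∷ x ∷ []) → Eval-decision (decB i x) }

  open Inverse θ (χAᴾ ⟨ zeroᴾ , arg₀ ⟩) (χBᴾ ⟨ zeroᴾ , arg₀ ⟩)
                 (λ x → decision-characterises (decA 0 x)) (λ x → decision-characterises (decB 0 x))

  Φ : ∀ z → 𝓜z A B z ≅ 𝓝z A B z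
  Φ (fset X) = ≅-if (evenB (card X)) (Iso⇒≅ θ) (Iso⇒≅ θ⁻¹)
  Φ (pt i false) = ≅-refl
  Φ (pt i true) = ≅-refl

  setComponentMap : ℕ → ℕ → ℕ
  setComponentMap X c = ifNonZero cardParity X then inverse c else fun θ c

  inSetComponent : ℕ → ℕ → ℕ
  inSetComponent X c = ifNonZero cardParity X then χB 0 c else χA 0 c

  inPointComponent : ℕ → ℕ → ℕ → ℕ
  inPointComponent i b c =
    ifNonZero equals b 0 then χA (suc i) c else (ifNonZero equals b 1 then χB (suc i) c else 0)

  -- A code ⟪ t , r ⟫ is a point of ℋ when t is 0 or 1; when t is 2 and r = ⟪ ⟪ t′ , r′ ⟫ , c ⟫ it is
  -- the element c of the component of the point ⟪ t′ , r′ ⟫.  ρ sends every other code to 0.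
  ρ-component : ℕ → ℕ → ℕ → ℕ
  ρ-component t′ r′ c =
    ifNonZero equals t′ 0
      then (ifNonZero inSetComponent r′ c then ⟪ 2 , ⟪ ⟪ 0 , r′ ⟫ , setComponentMap r′ c ⟫ ⟫ else 0)
      else (ifNonZero equals t′ 1
        then (ifNonZero inPointComponent (unpair₁ r′) (unpair₂ r′) c then ⟪ 2 , ⟪ ⟪ 1 , r′ ⟫ , c ⟫ ⟫ else 0)
        else 0)

  ρ-decoded : ℕ → ℕ → ℕ
  ρ-decoded t r =
    ifNonZero equals t 0 then ⟪ 0 , r ⟫
    else (ifNonZero equals t 1 then (ifNonZero isZero (unpair₂ r ∸ 1) then ⟪ 1 , r ⟫ else 0)
    else (ifNonZero equals t 2 then ρ-component (unpair₁ (unpair₁ r)) (unpair₂ (unpair₁ r)) (unpair₂ r)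
    else 0))

  ρ : ℕ → ℕ
  ρ n = ρ-decoded (unpair₁ n) (unpair₂ n)

  inSetComponentᴾ : Prog 2
  inSetComponentᴾ = withSem (ifᴾ cardParityᴾ ∘ᴾ arg₀ then χBᴾ ⟨ zeroᴾ , arg₁ ⟩ else χAᴾ ⟨ zeroᴾ , arg₁ ⟩)
    (binary inSetComponent) λ { (X ∷ c ∷ []) → refl }

  setComponentMapᴾ : Prog 2
  setComponentMapᴾ = withSem (ifᴾ cardParityᴾ ∘ᴾ arg₀ then inverseᴾ ∘ᴾ arg₁ else oracleᴾ ∘ᴾ arg₁)
    (binary setComponentMap) λ { (X ∷ c ∷ []) → refl }

  inPointComponentᴾ : Prog 3
  inPointComponentᴾ = withSem
    (ifᴾ equalsᴾ ⟨ arg₁ , zeroᴾ ⟩ then χAᴾ ⟨ sucᴾ ∘ᴾ arg₀ , arg₂ ⟩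
     else (ifᴾ equalsᴾ ⟨ arg₁ , constᴾ 1 ⟩ then χBᴾ ⟨ sucᴾ ∘ᴾ arg₀ , arg₂ ⟩ else zeroᴾ))
    (ternary inPointComponent) λ { (i ∷ b ∷ c ∷ []) → refl }

  ρ-componentᴾ : Prog 3
  ρ-componentᴾ = withSem
    (ifᴾ equalsᴾ ⟨ arg₀ , zeroᴾ ⟩
      then (ifᴾ inSetComponentᴾ ⟨ arg₁ , arg₂ ⟩
              then pairᴾ ⟨ constᴾ 2 , pairᴾ ⟨ pairᴾ ⟨ zeroᴾ , arg₁ ⟩ ,
                                             setComponentMapᴾ ⟨ arg₁ , arg₂ ⟩ ⟩ ⟩
              else zeroᴾ)
      else (ifᴾ equalsᴾ ⟨ arg₀ , constᴾ 1 ⟩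
        then (ifᴾ composeᴾ inPointComponentᴾ (unpair₁ᴾ ∘ᴾ arg₁ ∷ unpair₂ᴾ ∘ᴾ arg₁ ∷ arg₂ ∷ [])
                then pairᴾ ⟨ constᴾ 2 , pairᴾ ⟨ pairᴾ ⟨ constᴾ 1 , arg₁ ⟩ , arg₂ ⟩ ⟩
                else zeroᴾ)
        else zeroᴾ))
    (ternary ρ-component) λ { (t′ ∷ r′ ∷ c ∷ []) → refl }

  ρ-decodedᴾ : Prog 2
  ρ-decodedᴾ = withSem
    (ifᴾ equalsᴾ ⟨ arg₀ , zeroᴾ ⟩ then pairᴾ ⟨ zeroᴾ , arg₁ ⟩
     else (ifᴾ equalsᴾ ⟨ arg₀ , constᴾ 1 ⟩
       then (ifᴾ isZeroᴾ ∘ᴾ monusᴾ ⟨ unpair₂ᴾ ∘ᴾ arg₁ , constᴾ 1 ⟩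
               then pairᴾ ⟨ constᴾ 1 , arg₁ ⟩
               else zeroᴾ)
       else (ifᴾ equalsᴾ ⟨ arg₀ , constᴾ 2 ⟩
         then composeᴾ ρ-componentᴾ
                (unpair₁ᴾ ∘ᴾ unpair₁ᴾ ∘ᴾ arg₁ ∷ unpair₂ᴾ ∘ᴾ unpair₁ᴾ ∘ᴾ arg₁ ∷ unpair₂ᴾ ∘ᴾ arg₁ ∷ [])
         else zeroᴾ)))
    (binary ρ-decoded) λ { (t ∷ r ∷ []) → refl }

  ρᴾ : Prog 1
  ρᴾ = withSem (ρ-decodedᴾ ⟨ unpair₁ᴾ , unpair₂ᴾ ⟩) (unary ρ) λ { (n ∷ []) → refl }

  ρ≤Tθ : ρ ≤T fun θ
  ρ≤Tθ = code ρᴾ , λ n → eval ρᴾ (n ∷ [])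

  χA-yes : ∀ {i x} → Dom (A i) x → χA i x ≡ 1
  χA-yes {i} {x} = characterises-yes (decision-characterises (decA i x))

  χA-no : ∀ {i x} → ¬ Dom (A i) x → χA i x ≡ 0
  χA-no {i} {x} = characterises-no (decision-characterises (decA i x))

  χB-yes : ∀ {i x} → Dom (B i) x → χB i x ≡ 1
  χB-yes {i} {x} = characterises-yes (decision-characterises (decB i x))

  χB-no : ∀ {i x} → ¬ Dom (B i) x → χB i x ≡ 0
  χB-no {i} {x} = characterises-no (decision-characterises (decB i x))

  inSetComponent-characterises : ∀ X c → Characterises (inSetComponent X c) (Dom (𝓜z A B (fset X)) c)
  inSetComponent-characterises X c =
    cardParity-cases X (λ even p → Characterises (ifNonZero p then χB 0 c else χA 0 c)
                                                 (Dom (if even then A 0 else B 0) c))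
      (decision-characterises (decA 0 c)) (decision-characterises (decB 0 c))

  setComponentMap≡Φ : ∀ X c → setComponentMap X c ≡ to (Φ (fset X)) c
  setComponentMap≡Φ X c =
    cardParity-cases X (λ even p → (ifNonZero p then inverse c else fun θ c)
                                     ≡ to (≅-if even (Iso⇒≅ θ) (Iso⇒≅ θ⁻¹)) c)
      refl refl

  ρ-point : ∀ i b → ρ ⟪ 1 , ⟪ i , b ⟫ ⟫ ≡ (ifNonZero isZero (b ∸ 1) then ⟪ 1 , ⟪ i , b ⟫ ⟫ else 0)
  ρ-point i b =
    trans (unpair-β ρ-decoded 1 ⟪ i , b ⟫)
          (cong (λ b′ → ifNonZero isZero (b′ ∸ 1) then ⟪ 1 , ⟪ i , b ⟫ ⟫ else 0) (unpair₂-pair i b))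

  ρ-hcode : ∀ z → ρ (hcode z) ≡ hcode z
  ρ-hcode (fset X) = unpair-β ρ-decoded 0 X
  ρ-hcode (pt i false) = ρ-point i 0
  ρ-hcode (pt i true) = ρ-point i 1

  ρ-element : ∀ t′ r′ c → ρ ⟪ 2 , ⟪ ⟪ t′ , r′ ⟫ , c ⟫ ⟫ ≡ ρ-component t′ r′ c
  ρ-element t′ r′ c = begin
    ρ ⟪ 2 , ⟪ ⟪ t′ , r′ ⟫ , c ⟫ ⟫
      ≡⟨ unpair-β ρ-decoded 2 ⟪ ⟪ t′ , r′ ⟫ , c ⟫ ⟩
    ρ-decoded 2 ⟪ ⟪ t′ , r′ ⟫ , c ⟫
      ≡⟨ unpair-β (λ h c′ → ρ-component (unpair₁ h) (unpair₂ h) c′) ⟪ t′ , r′ ⟫ c ⟩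
    ρ-component (unpair₁ ⟪ t′ , r′ ⟫) (unpair₂ ⟪ t′ , r′ ⟫) c
      ≡⟨ unpair-β (λ t″ r″ → ρ-component t″ r″ c) t′ r′ ⟩
    ρ-component t′ r′ c ∎
    where open ≡-Reasoning

  ρ-point-element : ∀ i a c → ρ (ccode (pt i a) c)
                              ≡ (ifNonZero inPointComponent i (b2n a) c then ccode (pt i a) c else 0)
  ρ-point-element i a c =
    trans (ρ-element 1 ⟪ i , b2n a ⟫ c)
          (unpair-β (λ i′ b → ifNonZero inPointComponent i′ b c then ccode (pt i a) c else 0) i (b2n a))

  ρ-ccode : ∀ z {c} → Dom (𝓜z A B z) c → ρ (ccode z c) ≡ ccode z (to (Φ z) c)
  ρ-ccode (fset X) {c} c∈C = begin
    ρ (ccode (fset X) c)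
      ≡⟨ ρ-element 0 X c ⟩
    (ifNonZero inSetComponent X c then ccode (fset X) (setComponentMap X c) else 0)
      ≡⟨ cong (λ v → ifNonZero v then ccode (fset X) (setComponentMap X c) else 0)
              (characterises-yes (inSetComponent-characterises X c) c∈C) ⟩
    ccode (fset X) (setComponentMap X c)
      ≡⟨ cong (ccode (fset X)) (setComponentMap≡Φ X c) ⟩
    ccode (fset X) (to (Φ (fset X)) c) ∎
    where open ≡-Reasoning
  ρ-ccode (pt i false) {c} c∈A =
    trans (ρ-point-element i false c)
          (cong (λ v → ifNonZero v then ccode (pt i false) c else 0) (χA-yes c∈A))
  ρ-ccode (pt i true) {c} c∈B =
    trans (ρ-point-element i true c)
          (cong (λ v → ifNonZero v then ccode (pt i true) c else 0) (χB-yes c∈B))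

  DomM : ℕ → Set
  DomM = Dom (𝓜 A B)

  inPointComponent-off : ∀ i b c → ¬ DomM ⟪ 2 , ⟪ ⟪ 1 , ⟪ i , b ⟫ ⟫ , c ⟫ ⟫ → inPointComponent i b c ≡ 0
  inPointComponent-off i 0 c ∉M = χA-no (λ c∈A → ∉M (inj₂ (pt i false , c , c∈A , refl)))
  inPointComponent-off i 1 c ∉M = χB-no (λ c∈B → ∉M (inj₂ (pt i true , c , c∈B , refl)))
  inPointComponent-off i (suc (suc b)) c _ = refl

  ρ-component-off : ∀ t′ r′ c → ¬ DomM ⟪ 2 , ⟪ ⟪ t′ , r′ ⟫ , c ⟫ ⟫ → ρ-component t′ r′ c ≡ 0
  ρ-component-off 0 X c ∉M =
    cong (λ v → ifNonZero v then ccode (fset X) (setComponentMap X c) else 0)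
         (characterises-no (inSetComponent-characterises X c) (λ c∈C → ∉M (inj₂ (fset X , c , c∈C , refl))))
  ρ-component-off 1 r′ c ∉M =
    cong (λ v → ifNonZero v then ⟪ 2 , ⟪ ⟪ 1 , r′ ⟫ , c ⟫ ⟫ else 0)
         (inPointComponent-off (unpair₁ r′) (unpair₂ r′) c
           (∉M ∘ subst (λ r → DomM ⟪ 2 , ⟪ ⟪ 1 , r ⟫ , c ⟫ ⟫) (pair-unpair r′)))
  ρ-component-off (suc (suc t′)) r′ c _ = refl

  ρ-decoded-off : ∀ t r → ¬ DomM ⟪ t , r ⟫ → ρ-decoded t r ≡ 0
  ρ-decoded-off 0 X ∉M = ⊥-elim (∉M (inj₁ (fset X , refl)))
  ρ-decoded-off 1 r ∉M =
    point-off (unpair₁ r) (unpair₂ r) (∉M ∘ subst (λ r′ → DomM ⟪ 1 , r′ ⟫) (pair-unpair r))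
    where
    point-off : ∀ i b → ¬ DomM ⟪ 1 , ⟪ i , b ⟫ ⟫ → (ifNonZero isZero (b ∸ 1) then ⟪ 1 , r ⟫ else 0) ≡ 0
    point-off i 0 ∉M′ = ⊥-elim (∉M′ (inj₁ (pt i false , refl)))
    point-off i 1 ∉M′ = ⊥-elim (∉M′ (inj₁ (pt i true , refl)))
    point-off i (suc (suc b)) _ = refl
  ρ-decoded-off 2 r ∉M =
    ρ-component-off (unpair₁ (unpair₁ r)) (unpair₂ (unpair₁ r)) (unpair₂ r)
                    (∉M ∘ subst (λ r′ → DomM ⟪ 2 , r′ ⟫) pair-unpair²)
    where
    pair-unpair² : ⟪ ⟪ unpair₁ (unpair₁ r) , unpair₂ (unpair₁ r) ⟫ , unpair₂ r ⟫ ≡ r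
    pair-unpair² = trans (cong (λ h → ⟪ h , unpair₂ r ⟫) (pair-unpair (unpair₁ r))) (pair-unpair r)
  ρ-decoded-off (suc (suc (suc t))) r _ = refl

  ρ-off : ∀ n → ¬ DomM n → ρ n ≡ 0
  ρ-off n ∉M = ρ-decoded-off (unpair₁ n) (unpair₂ n) (∉M ∘ subst DomM (pair-unpair n))

  θ-readOff : ∀ x → unpair₂ (unpair₂ (ρ (ccode (fset 0) x))) ≡ fun θ x
  θ-readOff x = byMembership (decision-characterises (decA 0 x))
    where
    open ≡-Reasoning
    θx = to (Φ (fset 0)) x
    byMembership : Characterises (χA 0 x) (Dom (A 0) x) → unpair₂ (unpair₂ (ρ (ccode (fset 0) x))) ≡ fun θ x
    byMembership (inj₁ (_ , x∈A)) = begin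
      unpair₂ (unpair₂ (ρ (ccode (fset 0) x)))  ≡⟨ cong (unpair₂ ∘ unpair₂) (ρ-ccode (fset 0) x∈A) ⟩
      unpair₂ (unpair₂ (ccode (fset 0) θx))     ≡⟨ cong unpair₂ (unpair₂-pair 2 ⟪ hcode (fset 0) , θx ⟫) ⟩
      unpair₂ ⟪ hcode (fset 0) , θx ⟫           ≡⟨ unpair₂-pair (hcode (fset 0)) θx ⟩
      θx                                        ∎
    byMembership (inj₂ (_ , x∉A)) =
      trans (cong (unpair₂ ∘ unpair₂) (ρ-off (ccode (fset 0) x) (x∉A ∘ ccode-dom⁻ {𝓜z A B} (fset 0))))
            (sym (off-dom θ x x∉A))

  θ≤Tρ : fun θ ≤T ρ
  θ≤Tρ = readOff-≤T (fset 0) θ-readOff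

lemma3p14 : (A B : ℕ → Str) → UnifComputable A → UnifComputable B →
    ((i : ℕ) → Iso (A i) (B i)) →
    (θ : Iso (A 0) (B 0)) →
    Σ (Iso (𝓜 A B) (𝓝 A B)) λ ρ → fun ρ ≡T fun θ
lemma3p14 A B UA UB _ θ = CompositeIso.iso Φ ρ ρ-hcode ρ-ccode ρ-off , ρ≤Tθ , θ≤Tρ
  where open Construction A B UA UB θ
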